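{- Any comparison-based algorithm that partitions a permutation of $n$ elements into $\mathcal{O}(\sqrt{n})$ monotone subsequences requires $\Omega(n\log n)$ comparisons.
   Context: A monotone subsequence is a subsequence that is increasing or decreasing. In the comparison-based model the algorithm accesses the elements only through pairwise comparisons. -}

module Defs where

open import Data.Nat using (ℕ; zero; suc; _*_; _≤_)
open import Data.Fin using (Fin; _<_; _<?_)
open import Data.Fin.Permutation using (Permutation′; _⟨$⟩ʳ_)
open import Data.Product using (Σ; _×_; _,_)
open import Data.Sum using (_⊎_)
open import Relation.Nullary using (yes; no)
open import Relation.Binary.PropositionalEquality using (_≡_)
open import Function.Definitions using (Surjective)

-- An input: a permutation of n elements; element at position i has rank π(i).
Input : ℕ → Set
Input n = Permutation′ n

-- A comparison-based algorithm on n elements = a binary decision tree.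
-- node i j l r : compare the elements at positions i and j; continue with l
-- if element i < element j, with r otherwise.
-- leaf k f : output the partition of positions into parts labelled by Fin k.
data Tree (n : ℕ) : Set where
  leaf : (k : ℕ) → (Fin n → Fin k) → Tree n
  node : Fin n → Fin n → Tree n → Tree n → Tree n

output : ∀ {n} → Tree n → Input n → Σ ℕ (λ k → Fin n → Fin k)
output (leaf k f) π = k , f
output (node i j l r) π with (π ⟨$⟩ʳ i) <? (π ⟨$⟩ʳ j)
... | yes _ = output l π
... | no  _ = output r π

cost : ∀ {n} → Tree n → Input n → ℕ
cost (leaf k f) π = 0
cost (node i j l r) π with (π ⟨$⟩ʳ i) <? (π ⟨$⟩ʳ j)
... | yes _ = suc (cost l π)
... | no  _ = suc (cost r π)

IncreasingPart : ∀ {n k} → Input n → (Fin n → Fin k) → Fin k → Set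
IncreasingPart π f p = ∀ i j → f i ≡ p → f j ≡ p → i < j → (π ⟨$⟩ʳ i) < (π ⟨$⟩ʳ j)

DecreasingPart : ∀ {n k} → Input n → (Fin n → Fin k) → Fin k → Set
DecreasingPart π f p = ∀ i j → f i ≡ p → f j ≡ p → i < j → (π ⟨$⟩ʳ j) < (π ⟨$⟩ʳ i)

MonotonePart : ∀ {n k} → Input n → (Fin n → Fin k) → Fin k → Set
MonotonePart π f p = IncreasingPart π f p ⊎ DecreasingPart π f p

-- f is a partition of the n positions into exactly k (nonempty) monotone
-- subsequences, with k ≤ c·√n (written k² ≤ c²·n).
ValidOutput : (c n : ℕ) → Input n → Σ ℕ (λ k → Fin n → Fin k) → Set
ValidOutput c n π (k , f) =
  Surjective _≡_ _≡_ f × (k * k ≤ c * c * n) × (∀ p → MonotonePart π f p)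

Correct : (c n : ℕ) → Tree n → Set
Correct c n T = ∀ (π : Input n) → ValidOutput c n π (output T π)

-- With q = ⌊n/4⌋ and l = n − q, choosing for each of the l smallest ranks
-- one of the first q free positions gives q ^ l distinct inputs, roughly (n/4)^(3n/4). A correct
-- algorithm determines each of them from a short code: the outcomes of the at most h comparisons
-- on its path, the direction of every part, and the part labels listed in rank order (at most
-- K ≤ c√n labels), since placing the ranks one by one, monotonicity of the parts leaves a single
-- possible position each time. There are only 2^h · 2^n · K^n codes, about 2^h · (c√n)^n,
-- so h < n log₂ n / 8 is impossible once n is large.
module Submission where

open import Defs
open import Data.Nat
  using (ℕ; zero; suc; _+_; _*_; _∸_; _^_; ⌊_/2⌋; ⌈_/2⌉; _≤_; _<_; _≤?_; z≤n; s≤s; s≤s⁻¹;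
         NonZero; >-nonZero; >-nonZero⁻¹)
open import Data.Nat.Properties
open import Data.Nat.DivMod
  using (_/_; _%_; m≡m%n+[m/n]*n; m%n<n; m/n*n≤m; m*n/n≡m; /-monoˡ-≤; m≥n⇒m/n>0)
open import Data.Nat.Logarithm using (⌊log₂_⌋; ⌊log₂⌊n/2⌋⌋≡⌊log₂n⌋∸1; ⌊log₂⌋-mono-≤)
open import Data.Nat.Induction using (<-rec)
open import Data.Nat.Solver using (module +-*-Solver)
open import Data.Fin as Fin using (Fin; zero; suc; inject≤; punchIn; combine; funToFin; finToFun)
open import Data.Fin.Properties as Finₚ
  using (inject≤-injective; combine-injective; funToFin-finToFin; finToFun-funToFin; injective⇒≤)
import Data.Fin.Induction as Finᵢ
open import Data.Fin.Permutation
open import Data.Vec.Functional using (Vector; []; _∷_)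
open import Data.Product using (Σ; _×_; _,_; proj₁; proj₂; ∃)
open import Data.Sum using (_⊎_; inj₁; inj₂)
open import Function using (_∘_)
open import Induction.WellFounded using (module All)
open import Relation.Binary using (tri<; tri≈; tri>)
open import Relation.Binary.PropositionalEquality
open import Relation.Nullary using (yes; no; ¬_)
open import Relation.Nullary.Negation using (contradiction)
open +-*-Solver using (solve; _:*_; _:^_; _:=_; con)

⟨$⟩ʳ-injective : ∀ {n} (π : Permutation′ n) {i j} → π ⟨$⟩ʳ i ≡ π ⟨$⟩ʳ j → i ≡ j
⟨$⟩ʳ-injective π {i} {j} eq = trans (sym (inverseˡ π)) (trans (cong (π ⟨$⟩ˡ_) eq) (inverseˡ π))

⟨$⟩ˡ-injective : ∀ {n} (π : Permutation′ n) {i j} → π ⟨$⟩ˡ i ≡ π ⟨$⟩ˡ j → i ≡ j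
⟨$⟩ˡ-injective π {i} {j} eq = trans (sym (inverseʳ π)) (trans (cong (π ⟨$⟩ʳ_) eq) (inverseʳ π))

⟨$⟩ˡ-≗⇒≈ : ∀ {n} (π ρ : Permutation′ n) → (∀ r → π ⟨$⟩ˡ r ≡ ρ ⟨$⟩ˡ r) → π ≈ ρ
⟨$⟩ˡ-≗⇒≈ π ρ eq i = begin
  π ⟨$⟩ʳ i                    ≡⟨ cong (π ⟨$⟩ʳ_) (sym (inverseˡ ρ)) ⟩
  π ⟨$⟩ʳ (ρ ⟨$⟩ˡ (ρ ⟨$⟩ʳ i))  ≡⟨ cong (π ⟨$⟩ʳ_) (sym (eq (ρ ⟨$⟩ʳ i))) ⟩
  π ⟨$⟩ʳ (π ⟨$⟩ˡ (ρ ⟨$⟩ʳ i))  ≡⟨ inverseʳ π ⟩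
  ρ ⟨$⟩ʳ i                    ∎
  where open ≡-Reasoning

funToFin-cong : ∀ {m n} {f g : Fin m → Fin n} → (∀ i → f i ≡ g i) → funToFin f ≡ funToFin g
funToFin-cong {zero}  eq = refl
funToFin-cong {suc m} eq = cong₂ combine (eq zero) (funToFin-cong (eq ∘ suc))

funToFin-injective : ∀ {m n} {f g : Fin m → Fin n} → funToFin f ≡ funToFin g → ∀ i → f i ≡ g i
funToFin-injective {f = f} {g} eq i =
  trans (sym (finToFun-funToFin f i)) (trans (cong (λ x → finToFun x i) eq) (finToFun-funToFin g i))

combine-funToFin-injective : ∀ {a b m n} {f f′ : Fin a → Fin m} {g g′ : Fin b → Fin n} →
  combine (funToFin f) (funToFin g) ≡ combine (funToFin f′) (funToFin g′) →
  (∀ i → f i ≡ f′ i) × (∀ j → g j ≡ g′ j)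
combine-funToFin-injective {f = f} {f′} {g} {g′} eq =
  funToFin-injective (proj₁ halves) , funToFin-injective (proj₂ halves)
  where
  halves : funToFin f ≡ funToFin f′ × funToFin g ≡ funToFin g′
  halves = combine-injective (funToFin f) (funToFin g) (funToFin f′) (funToFin g′) eq

path : ∀ {n} h → Tree n → Input n → Vector (Fin 2) h
path zero    _              _ = []
path (suc h) (leaf k f)     π = zero ∷ path h (leaf k f) π
path (suc h) (node i j l r) π with (π ⟨$⟩ʳ i) Fin.<? (π ⟨$⟩ʳ j)
... | yes _ = zero ∷ path h l π
... | no  _ = suc zero ∷ path h r π

output-determined-by-path : ∀ {n} h (T : Tree n) {π₁ π₂ : Input n} →
  cost T π₁ ≤ h → cost T π₂ ≤ h → (∀ t → path h T π₁ t ≡ path h T π₂ t) → output T π₁ ≡ output T π₂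
output-determined-by-path h (leaf k f) _ _ _ = refl
output-determined-by-path zero (node i j l r) {π₁} c₁ _ _ with (π₁ ⟨$⟩ʳ i) Fin.<? (π₁ ⟨$⟩ʳ j)
output-determined-by-path zero (node i j l r) () _ _ | yes _
output-determined-by-path zero (node i j l r) () _ _ | no _
output-determined-by-path (suc h) (node i j l r) {π₁} {π₂} c₁ c₂ eq
  with (π₁ ⟨$⟩ʳ i) Fin.<? (π₁ ⟨$⟩ʳ j) | (π₂ ⟨$⟩ʳ i) Fin.<? (π₂ ⟨$⟩ʳ j)
... | yes _ | yes _ = output-determined-by-path h l (s≤s⁻¹ c₁) (s≤s⁻¹ c₂) (eq ∘ suc)
... | no  _ | no  _ = output-determined-by-path h r (s≤s⁻¹ c₁) (s≤s⁻¹ c₂) (eq ∘ suc)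
... | yes _ | no  _ = contradiction (eq zero) λ ()
... | no  _ | yes _ = contradiction (eq zero) λ ()

side : ∀ {A B : Set} → A ⊎ B → Fin 2
side (inj₁ _) = zero
side (inj₂ _) = suc zero

same-side : ∀ {A₁ B₁ A₂ B₂ : Set} (x : A₁ ⊎ B₁) (y : A₂ ⊎ B₂) → side x ≡ side y → A₂ ⊎ B₁
same-side (inj₁ _) (inj₁ a) _ = inj₁ a
same-side (inj₂ b) (inj₂ _) _ = inj₂ b

-- If ranks below r have the same position in π₁ and π₂, the element of rank r cannot sit
-- further left in π₁ than in π₂: its part would force a smaller rank onto one of the two positions.
no-earlier-position : ∀ {n k} (f : Fin n → Fin k) (π₁ π₂ : Input n) →
  (∀ i → IncreasingPart π₂ f (f i) ⊎ DecreasingPart π₁ f (f i)) →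
  ∀ r → (∀ {r′} → r′ Fin.< r → π₁ ⟨$⟩ˡ r′ ≡ π₂ ⟨$⟩ˡ r′) →
  f (π₁ ⟨$⟩ˡ r) ≡ f (π₂ ⟨$⟩ˡ r) → ¬ (π₁ ⟨$⟩ˡ r Fin.< π₂ ⟨$⟩ˡ r)
no-earlier-position {n} f π₁ π₂ monotone r below same-part i₁<i₂ with monotone (π₁ ⟨$⟩ˡ r)
... | inj₁ increasing₂ = Finₚ.<-irrefl r′≡r r′<r
  where
  r′ : Fin n
  r′ = π₂ ⟨$⟩ʳ (π₁ ⟨$⟩ˡ r)
  r′<r : r′ Fin.< r
  r′<r = subst (r′ Fin.<_) (inverseʳ π₂) (increasing₂ _ _ refl (sym same-part) i₁<i₂)
  r′≡r : r′ ≡ r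
  r′≡r = ⟨$⟩ˡ-injective π₁ (trans (below r′<r) (inverseˡ π₂))
... | inj₂ decreasing₁ = Finₚ.<-irrefl r′≡r r′<r
  where
  r′ : Fin n
  r′ = π₁ ⟨$⟩ʳ (π₂ ⟨$⟩ˡ r)
  r′<r : r′ Fin.< r
  r′<r = subst (r′ Fin.<_) (inverseʳ π₁) (decreasing₁ _ _ refl (sym same-part) i₁<i₂)
  r′≡r : r′ ≡ r
  r′≡r = ⟨$⟩ˡ-injective π₂ (trans (sym (below r′<r)) (inverseˡ π₁))

partition-determines-input : ∀ {n k} (f : Fin n → Fin k) (π₁ π₂ : Input n)
  (monotone₁ : ∀ p → MonotonePart π₁ f p) (monotone₂ : ∀ p → MonotonePart π₂ f p) →
  (∀ i → side (monotone₁ (f i)) ≡ side (monotone₂ (f i))) →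
  (∀ r → f (π₁ ⟨$⟩ˡ r) ≡ f (π₂ ⟨$⟩ˡ r)) → π₁ ≈ π₂
partition-determines-input f π₁ π₂ monotone₁ monotone₂ sides labels =
  ⟨$⟩ˡ-≗⇒≈ π₁ π₂ (All.wfRec Finᵢ.<-wellFounded _ _ placed)
  where
  placed : ∀ r → (∀ {r′} → r′ Fin.< r → π₁ ⟨$⟩ˡ r′ ≡ π₂ ⟨$⟩ˡ r′) → π₁ ⟨$⟩ˡ r ≡ π₂ ⟨$⟩ˡ r
  placed r below with Finₚ.<-cmp (π₁ ⟨$⟩ˡ r) (π₂ ⟨$⟩ˡ r)
  ... | tri≈ _ eq _ = eq
  ... | tri< lt _ _ = contradiction lt
    (no-earlier-position f π₁ π₂ (λ i → same-side (monotone₁ (f i)) (monotone₂ (f i)) (sides i))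
      r below (labels r))
  ... | tri> _ _ gt = contradiction gt
    (no-earlier-position f π₂ π₁ (λ i → same-side (monotone₂ (f i)) (monotone₁ (f i)) (sym (sides i)))
      r (sym ∘ below) (sym (labels r)))

module _ {c n} (T : Tree n) (correct : Correct c n T)
         {K : ℕ} (k≤K : ∀ {k} → k * k ≤ c * c * n → k ≤ K) where

  outputCode : (π : Input n) (o : Σ ℕ (λ k → Fin n → Fin k)) → ValidOutput c n π o →
    Fin (2 ^ n * K ^ n)
  outputCode π (k , f) (_ , k² , monotone) =
    combine (funToFin (λ i → side (monotone (f i))))
            (funToFin (λ r → inject≤ (f (π ⟨$⟩ˡ r)) (k≤K k²)))

  outputCode-injective : ∀ {π₁ π₂ o₁ o₂} → o₁ ≡ o₂ →
    (valid₁ : ValidOutput c n π₁ o₁) (valid₂ : ValidOutput c n π₂ o₂) →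
    outputCode π₁ o₁ valid₁ ≡ outputCode π₂ o₂ valid₂ → π₁ ≈ π₂
  outputCode-injective {π₁} {π₂} {k , f} refl (_ , _ , monotone₁) (_ , _ , monotone₂) eq
    with combine-funToFin-injective eq
  ... | sides , labels = partition-determines-input f π₁ π₂ monotone₁ monotone₂ sides
    (λ r → inject≤-injective _ _ _ _ (labels r))

  code : ∀ h → Input n → Fin (2 ^ h * (2 ^ n * K ^ n))
  code h π = combine (funToFin (path h T π)) (outputCode π (output T π) (correct π))

  code-injective : ∀ h {π₁ π₂} → cost T π₁ ≤ h → cost T π₂ ≤ h → code h π₁ ≡ code h π₂ → π₁ ≈ π₂
  code-injective h {π₁} {π₂} c₁ c₂ eq =
    outputCode-injective {π₁} {π₂} {output T π₁} {output T π₂}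
      (output-determined-by-path h T c₁ c₂ (funToFin-injective (proj₁ halves)))
      (correct π₁) (correct π₂) (proj₂ halves)
    where
    halves : funToFin (path h T π₁) ≡ funToFin (path h T π₂) ×
             outputCode π₁ (output T π₁) (correct π₁) ≡ outputCode π₂ (output T π₂) (correct π₂)
    halves = combine-injective _ _ _ _ eq

  cheap-family-size : ∀ {N} h (F : Fin N → Input n) → (∀ {x y} → F x ≈ F y → x ≡ y) →
    (∀ x → cost T (F x) ≤ h) → N ≤ 2 ^ h * (2 ^ n * K ^ n)
  cheap-family-size h F F-injective cheap =
    injective⇒≤ (λ {x} {y} eq → F-injective (code-injective h (cheap x) (cheap y) eq))

-- In insertions l c the element of rank t < l sits at the (c t)-th position not taken by
-- smaller ranks; the last m ranks fill the remaining positions in order.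
insertions : ∀ {m} l → (Fin l → Fin m) → Input (l + m)
insertions     zero    _ = id
insertions {m} (suc l) c = insert (inject≤ (c zero) (m≤n+m m (suc l))) zero (insertions l (c ∘ suc))

insert-self : ∀ {a b} (i : Fin (suc a)) (j : Fin (suc b)) (π : Permutation a b) → insert i j π ⟨$⟩ʳ i ≡ j
insert-self i j π with i Finₚ.≟ i
... | yes _  = refl
... | no i≢i = contradiction refl i≢i

insertions-injective : ∀ {m} l {c c′ : Fin l → Fin m} →
  insertions l c ≈ insertions l c′ → ∀ t → c t ≡ c′ t
insertions-injective zero _ ()
insertions-injective {m} (suc l) {c} {c′} eq = λ
  { zero    → first
  ; (suc t) → insertions-injective l rest t
  }
  where
  open ≡-Reasoning
  ι : Fin m → Fin (suc (l + m))
  ι x = inject≤ x (m≤n+m m (suc l))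
  ρ ρ′ : Input (suc l + m)
  ρ  = insertions (suc l) c
  ρ′ = insertions (suc l) c′
  first : c zero ≡ c′ zero
  first = inject≤-injective _ _ _ _ (⟨$⟩ʳ-injective ρ′ (begin
    ρ′ ⟨$⟩ʳ ι (c zero)  ≡⟨ sym (eq (ι (c zero))) ⟩
    ρ ⟨$⟩ʳ ι (c zero)   ≡⟨ insert-self (ι (c zero)) zero _ ⟩
    zero                ≡⟨ sym (insert-self (ι (c′ zero)) zero _) ⟩
    ρ′ ⟨$⟩ʳ ι (c′ zero) ∎))
  rest : insertions l (c ∘ suc) ≈ insertions l (c′ ∘ suc)
  rest k = Finₚ.suc-injective (begin
    suc (insertions l (c ∘ suc) ⟨$⟩ʳ k)   ≡⟨ sym (insert-punchIn (ι (c zero)) zero _ k) ⟩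
    ρ ⟨$⟩ʳ punchIn (ι (c zero)) k         ≡⟨ eq _ ⟩
    ρ′ ⟨$⟩ʳ punchIn (ι (c zero)) k        ≡⟨ cong (λ x → ρ′ ⟨$⟩ʳ punchIn (ι x) k) first ⟩
    ρ′ ⟨$⟩ʳ punchIn (ι (c′ zero)) k       ≡⟨ insert-punchIn (ι (c′ zero)) zero _ k ⟩
    suc (insertions l (c′ ∘ suc) ⟨$⟩ʳ k)  ∎)

insertionFamily : ∀ {m} l → Fin (m ^ l) → Input (l + m)
insertionFamily {m} l x = insertions l (finToFun {m} {l} x)

insertionFamily-injective : ∀ {m} l {x y : Fin (m ^ l)} →
  insertionFamily l x ≈ insertionFamily l y → x ≡ y
insertionFamily-injective {m} l {x} {y} eq = begin
  x                             ≡⟨ sym (funToFin-finToFin {l} {m} x) ⟩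
  funToFin (finToFun {m} {l} x) ≡⟨ funToFin-cong (insertions-injective l eq) ⟩
  funToFin (finToFun {m} {l} y) ≡⟨ funToFin-finToFin {l} {m} y ⟩
  y                             ∎
  where open ≡-Reasoning

2^⌊log₂n⌋≤n : ∀ n .{{_ : NonZero n}} → 2 ^ ⌊log₂ n ⌋ ≤ n
2^⌊log₂n⌋≤n (suc n) = <-rec _ step n
  where
  open ≤-Reasoning
  step : ∀ n → (∀ {m} → m < n → 2 ^ ⌊log₂ suc m ⌋ ≤ suc m) → 2 ^ ⌊log₂ suc n ⌋ ≤ suc n
  step zero    _  = ≤-refl
  step (suc k) IH = begin
    2 ^ L                       ≡⟨ cong (2 ^_) (sym (m+[n∸m]≡n 1≤L)) ⟩
    2 * 2 ^ (L ∸ 1)             ≡⟨ cong (λ e → 2 * 2 ^ e) (sym (⌊log₂⌊n/2⌋⌋≡⌊log₂n⌋∸1 N)) ⟩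
    2 * 2 ^ ⌊log₂ ⌊ N /2⌋ ⌋     ≤⟨ *-monoʳ-≤ 2 (IH (s≤s (⌊n/2⌋≤n k))) ⟩
    2 * ⌊ N /2⌋                 ≡⟨ cong (⌊ N /2⌋ +_) (+-identityʳ ⌊ N /2⌋) ⟩
    ⌊ N /2⌋ + ⌊ N /2⌋           ≤⟨ +-monoʳ-≤ ⌊ N /2⌋ (⌊n/2⌋≤⌈n/2⌉ N) ⟩
    ⌊ N /2⌋ + ⌈ N /2⌉           ≡⟨ ⌊n/2⌋+⌈n/2⌉≡n N ⟩
    N                           ∎
    where
    N L : ℕ
    N = suc (suc k)
    L = ⌊log₂ N ⌋
    1≤L : 1 ≤ L
    1≤L = ⌊log₂⌋-mono-≤ {2} {N} (s≤s (s≤s z≤n))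

m+n≢0 : ∀ m n .{{_ : NonZero n}} → NonZero (m + n)
m+n≢0 m n = >-nonZero (≤-trans (>-nonZero⁻¹ n) (m≤n+m n m))

^-distribʳ-* : ∀ m n o → (m * n) ^ o ≡ m ^ o * n ^ o
^-distribʳ-* m n zero    = refl
^-distribʳ-* m n (suc o) = begin
  m * n * (m * n) ^ o     ≡⟨ cong (m * n *_) (^-distribʳ-* m n o) ⟩
  m * n * (m ^ o * n ^ o) ≡⟨ [m*n]*[o*p]≡[m*o]*[n*p] m n (m ^ o) (n ^ o) ⟩
  m ^ suc o * n ^ suc o   ∎
  where open ≡-Reasoning

^-swap : ∀ m n o → (m ^ n) ^ o ≡ (m ^ o) ^ n
^-swap m n o = trans (^-*-assoc m n o) (trans (cong (m ^_) (*-comm n o)) (sym (^-*-assoc m o n)))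

^-cancelˡ-≤ : ∀ {m o} n .{{_ : NonZero n}} → m ^ n ≤ o ^ n → m ≤ o
^-cancelˡ-≤ {m} {o} n le with m ≤? o
... | yes m≤o = m≤o
... | no  m≰o = contradiction le (<⇒≱ (^-monoˡ-< n (≰⇒> m≰o)))

[m^6]^[l+m]≤[m^l]^8 : ∀ {m l} .{{_ : NonZero m}} → 3 * m ≤ l → (m ^ 6) ^ (l + m) ≤ (m ^ l) ^ 8
[m^6]^[l+m]≤[m^l]^8 {m} {l} 3m≤l = begin
  (m ^ 6) ^ (l + m)   ≡⟨ ^-*-assoc m 6 (l + m) ⟩
  m ^ (6 * (l + m))   ≤⟨ ^-monoʳ-≤ m exponents ⟩
  m ^ (l * 8)         ≡⟨ sym (^-*-assoc m l 8) ⟩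
  (m ^ l) ^ 8         ∎
  where
  open ≤-Reasoning
  exponents : 6 * (l + m) ≤ l * 8
  exponents = begin
    6 * (l + m)         ≡⟨ *-distribˡ-+ 6 l m ⟩
    6 * l + 6 * m       ≡⟨ cong (6 * l +_) (*-assoc 2 3 m) ⟩
    6 * l + 2 * (3 * m) ≤⟨ +-monoʳ-≤ (6 * l) (*-monoʳ-≤ 2 3m≤l) ⟩
    6 * l + 2 * l       ≡⟨ sym (*-distribʳ-+ l 6 2) ⟩
    8 * l               ≡⟨ *-comm 8 l ⟩
    l * 8               ∎

code-count-bound : ∀ c {n h L K} → h * 8 ≤ n * L → 2 ^ L ≤ n → K * K ≤ c * c * n →
  (2 ^ h * (2 ^ n * K ^ n)) ^ 8 ≤ (2 ^ 8 * c ^ 8 * n ^ 5) ^ n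
code-count-bound c {n} {h} {L} {K} h≤nL/8 2^L≤n K²≤c²n = begin
  (2 ^ h * (2 ^ n * K ^ n)) ^ 8
    ≡⟨ ^-distribʳ-* (2 ^ h) _ 8 ⟩
  (2 ^ h) ^ 8 * (2 ^ n * K ^ n) ^ 8
    ≡⟨ cong ((2 ^ h) ^ 8 *_) (^-distribʳ-* (2 ^ n) (K ^ n) 8) ⟩
  (2 ^ h) ^ 8 * ((2 ^ n) ^ 8 * (K ^ n) ^ 8)
    ≤⟨ *-mono-≤ paths (*-mono-≤ (≤-reflexive (^-swap 2 n 8)) labels) ⟩
  n ^ n * ((2 ^ 8) ^ n * ((c * c * n) ^ 4) ^ n) ≡⟨ cong (n ^ n *_) (sym (^-distribʳ-* (2 ^ 8) _ n)) ⟩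
  n ^ n * (2 ^ 8 * (c * c * n) ^ 4) ^ n         ≡⟨ sym (^-distribʳ-* n _ n) ⟩
  (n * (2 ^ 8 * (c * c * n) ^ 4)) ^ n           ≡⟨ cong (_^ n) (regroup c n) ⟩
  (2 ^ 8 * c ^ 8 * n ^ 5) ^ n                   ∎
  where
  open ≤-Reasoning
  paths : (2 ^ h) ^ 8 ≤ n ^ n
  paths = begin
    (2 ^ h) ^ 8 ≡⟨ ^-*-assoc 2 h 8 ⟩
    2 ^ (h * 8) ≤⟨ ^-monoʳ-≤ 2 h≤nL/8 ⟩
    2 ^ (n * L) ≡⟨ cong (2 ^_) (*-comm n L) ⟩
    2 ^ (L * n) ≡⟨ sym (^-*-assoc 2 L n) ⟩
    (2 ^ L) ^ n ≤⟨ ^-monoˡ-≤ n 2^L≤n ⟩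
    n ^ n       ∎
  square-power : ∀ K → K ^ 8 ≡ (K * K) ^ 4
  square-power = solve 1 (λ K → K :^ 8 := (K :* K) :^ 4) refl
  labels : (K ^ n) ^ 8 ≤ ((c * c * n) ^ 4) ^ n
  labels = begin
    (K ^ n) ^ 8           ≡⟨ ^-swap K n 8 ⟩
    (K ^ 8) ^ n           ≡⟨ cong (_^ n) (square-power K) ⟩
    ((K * K) ^ 4) ^ n     ≤⟨ ^-monoˡ-≤ n (^-monoˡ-≤ 4 K²≤c²n) ⟩
    ((c * c * n) ^ 4) ^ n ∎
  regroup : ∀ c n → n * (2 ^ 8 * (c * c * n) ^ 4) ≡ 2 ^ 8 * c ^ 8 * n ^ 5
  regroup = solve 2 (λ c n → n :* (con (2 ^ 8) :* (c :* c :* n) :^ 4)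
                          := con (2 ^ 8) :* c :^ 8 :* n :^ 5) refl

few-codes⇒l+m≤2^26*c^8 : ∀ c {l m h L K} .{{_ : NonZero m}} → 3 * m ≤ l → l ≤ 7 * m →
  h * 8 ≤ (l + m) * L → 2 ^ L ≤ l + m → K * K ≤ c * c * (l + m) →
  m ^ l ≤ 2 ^ h * (2 ^ (l + m) * K ^ (l + m)) → l + m ≤ 2 ^ 26 * c ^ 8
few-codes⇒l+m≤2^26*c^8 c {l} {m} {h} {L} {K} 3m≤l l≤7m h≤nL/8 2^L≤n K²≤c²n count =
  *-cancelʳ-≤ n (2 ^ 26 * c ^ 8) (n ^ 5) {{m^n≢0 n 5}} (begin
    n ^ 6                           ≤⟨ ^-monoˡ-≤ 6 n≤8m ⟩
    (8 * m) ^ 6                     ≡⟨ ^-distribʳ-* 8 m 6 ⟩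
    8 ^ 6 * m ^ 6                   ≤⟨ *-monoʳ-≤ (8 ^ 6) m⁶-bound ⟩
    8 ^ 6 * (2 ^ 8 * c ^ 8 * n ^ 5) ≡⟨ regroup c n ⟩
    2 ^ 26 * c ^ 8 * n ^ 5          ∎)
  where
  open ≤-Reasoning
  n : ℕ
  n = l + m
  instance
    n≢0 : NonZero n
    n≢0 = m+n≢0 l m
  n≤8m : n ≤ 8 * m
  n≤8m = begin
    l + m     ≤⟨ +-monoˡ-≤ m l≤7m ⟩
    7 * m + m ≡⟨ +-comm (7 * m) m ⟩
    8 * m     ∎
  m⁶-bound : m ^ 6 ≤ 2 ^ 8 * c ^ 8 * n ^ 5
  m⁶-bound = ^-cancelˡ-≤ n (begin
    (m ^ 6) ^ n                   ≤⟨ [m^6]^[l+m]≤[m^l]^8 3m≤l ⟩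
    (m ^ l) ^ 8                   ≤⟨ ^-monoˡ-≤ 8 count ⟩
    (2 ^ h * (2 ^ n * K ^ n)) ^ 8 ≤⟨ code-count-bound c {n} {h} {L} {K} h≤nL/8 2^L≤n K²≤c²n ⟩
    (2 ^ 8 * c ^ 8 * n ^ 5) ^ n   ∎)
  -- 8 ^ 6 * 2 ^ 8 and 2 ^ 26 normalise to the same numeral.
  regroup : ∀ c n → 8 ^ 6 * (2 ^ 8 * c ^ 8 * n ^ 5) ≡ 2 ^ 26 * c ^ 8 * n ^ 5
  regroup c n = trans (sym (*-assoc (8 ^ 6) (2 ^ 8 * c ^ 8) (n ^ 5)))
                      (cong (_* n ^ 5) (sym (*-assoc (8 ^ 6) (2 ^ 8) (c ^ 8))))

integer-sqrt : ∀ X → ∃ λ K → K * K ≤ X × X < suc K * suc K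
integer-sqrt zero = 0 , z≤n , s≤s z≤n
integer-sqrt (suc X) with integer-sqrt X
... | K , K²≤X , X<[1+K]² with suc K * suc K ≤? suc X
...   | yes [1+K]²≤1+X = suc K , [1+K]²≤1+X , <-≤-trans (s≤s X<[1+K]²) [1+K]²<[2+K]²
  where
  [1+K]²<[2+K]² : suc K * suc K < suc (suc K) * suc (suc K)
  [1+K]²<[2+K]² = *-mono-< (n<1+n (suc K)) (n<1+n (suc K))
...   | no  [1+K]²≰1+X = K , m≤n⇒m≤1+n K²≤X , ≰⇒> [1+K]²≰1+X

sqrt-greatest : ∀ {X K k} → X < suc K * suc K → k * k ≤ X → k ≤ K
sqrt-greatest X<[1+K]² k²≤X = ≮⇒≥ λ K<k → <⇒≱ X<[1+K]² (≤-trans (*-mono-≤ K<k K<k) k²≤X)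

m*n≤o⇒m≤o/n : ∀ m {n o} .{{_ : NonZero n}} → m * n ≤ o → m ≤ o / n
m*n≤o⇒m≤o/n m {n} m*n≤o = subst (_≤ _) (m*n/n≡m m n) (/-monoˡ-≤ n m*n≤o)

CostLowerBound : ℕ → ℕ → ℕ → Set
CostLowerBound c d n = (T : Tree n) → Correct c n T → Σ (Input n) λ π → n * ⌊log₂ n ⌋ ≤ d * cost T π

insertions-lower-bound : ∀ c {l m} .{{_ : NonZero m}} → 3 * m ≤ l → l ≤ 7 * m →
  2 ^ 26 * c ^ 8 < l + m → CostLowerBound c 8 (l + m)
insertions-lower-bound c {l} {m} 3m≤l l≤7m large T correct = insertionFamily l x , expensive
  where
  n L h K : ℕ
  n = l + m
  L = ⌊log₂ n ⌋
  h = n * L / 8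
  K = proj₁ (integer-sqrt (c * c * n))
  instance
    n≢0 : NonZero n
    n≢0 = m+n≢0 l m
  K²≤c²n : K * K ≤ c * c * n
  K²≤c²n = proj₁ (proj₂ (integer-sqrt (c * c * n)))
  c²n<[1+K]² : c * c * n < suc K * suc K
  c²n<[1+K]² = proj₂ (proj₂ (integer-sqrt (c * c * n)))
  not-all-cheap : ¬ (∀ x → cost T (insertionFamily l x) ≤ h)
  not-all-cheap cheap = <⇒≱ large
    (few-codes⇒l+m≤2^26*c^8 c {l} {m} {h} {L} {K} 3m≤l l≤7m (m/n*n≤m (n * L) 8) (2^⌊log₂n⌋≤n n) K²≤c²n
      (cheap-family-size {c} T correct (sqrt-greatest c²n<[1+K]²) h (insertionFamily l)
        (insertionFamily-injective l) cheap))
  costly : ∃ λ x → ¬ cost T (insertionFamily l x) ≤ h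
  costly = Finₚ.¬∀⟶∃¬ (m ^ l) _ (λ x → cost T (insertionFamily l x) ≤? h) not-all-cheap
  x : Fin (m ^ l)
  x = proj₁ costly
  expensive : n * L ≤ 8 * cost T (insertionFamily l x)
  expensive = ≮⇒≥ λ 8c<nL → proj₂ costly (m*n≤o⇒m≤o/n _
    (subst (_≤ n * L) (*-comm 8 (cost T (insertionFamily l x))) (<⇒≤ 8c<nL)))

cost-lower-bound : ∀ c n → 2 ^ 26 * c ^ 8 + 4 ≤ n → CostLowerBound c 8 n
cost-lower-bound c n large = subst (CostLowerBound c 8) l+q≡n
  (insertions-lower-bound c {l} {q} (m≤n+m (3 * q) r) l≤7q
    (subst (2 ^ 26 * c ^ 8 <_) (sym l+q≡n) (<-≤-trans (m<m+n _ 0<1+n) large)))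
  where
  q r l : ℕ
  q = n / 4
  r = n % 4
  l = r + 3 * q
  instance
    q≢0 : NonZero q
    q≢0 = >-nonZero (m≥n⇒m/n>0 (≤-trans (m≤n+m 4 _) large))
  l+q≡n : l + q ≡ n
  l+q≡n = begin
    r + 3 * q + q   ≡⟨ +-assoc r (3 * q) q ⟩
    r + (3 * q + q) ≡⟨ cong (r +_) (trans (+-comm (3 * q) q) (*-comm 4 q)) ⟩
    r + q * 4       ≡⟨ sym (m≡m%n+[m/n]*n n 4) ⟩
    n               ∎
    where open ≡-Reasoning
  l≤7q : l ≤ 7 * q
  l≤7q = begin
    r + 3 * q     ≤⟨ +-monoˡ-≤ (3 * q) (≤-trans (<⇒≤ (m%n<n n 4)) (*-monoʳ-≤ 4 (>-nonZero⁻¹ q))) ⟩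
    4 * q + 3 * q ≡⟨ sym (*-distribʳ-+ q 4 3) ⟩
    7 * q         ∎
    where open ≤-Reasoning

lemma20 : ∀ (c : ℕ) → Σ ℕ λ d → Σ ℕ λ N →
    ∀ (n : ℕ) → N ≤ n → (T : Tree n) → Correct c n T →
      Σ (Input n) λ π → n * ⌊log₂ n ⌋ ≤ d * cost T π
lemma20 c = 8 , 2 ^ 26 * c ^ 8 + 4 , cost-lower-bound c
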